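{- Any optimal PNOI policy never takes an action with a negative expected marginal payoff in any round; that is, at every decision point reached with positive probability, the expected marginal payoff of the chosen action, conditioned on the history so far, is nonnegative.
   Context: An instance of PNOI consists of $n$ boxes; box $i$ has cost $c_i\ge0$ and hidden value $v_i\ge0$ drawn independently from a known finitely supported distribution $F_i$. A policy proceeds in rounds choosing actions: $a_i^0$ = open box $i$ (pay $c_i$, observe $v_i$); $a_i^1$ = take box $i$ without opening it and end; $\mathsf{end}$ = take the highest value seen so far and end. The state $I$ is the largest value revealed so far (initially $I=0$). The marginal payoffs are $G(I,a_i^0)=\max\{I,v_i\}-I-c_i$, $G(I,a_i^1)=\mathbb{E}[v_i]-I$, $G(I,\mathsf{end})=0$; the payoff of a policy equals the sum of the marginal payoffs of its actions, which coincides with the PNOI payoff (value taken minus total cost paid) for policies that never take an unopened box with expected value below the current state. An optimal policy maximizes expected payoff.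
   Formalization: The costs $c_i$ and the values and probabilities of the distributions $F_i$ are rational. -}

module Defs where

open import Data.Nat using (ℕ)
open import Data.Fin using (Fin)
open import Data.Rational using (ℚ; 0ℚ; 1ℚ; _+_; _*_; _-_; _⊔_; _≤_; _<_)
open import Data.Product using (_×_; _,_; proj₁; proj₂)
open import Data.List using (List; []; _∷_; map; foldr)
open import Data.List.Membership.Propositional using (_∈_; _∉_)
open import Data.List.Relation.Unary.All using (All)
open import Relation.Binary.PropositionalEquality using (_≡_)

sumℚ : List ℚ → ℚ
sumℚ = foldr _+_ 0ℚ

-- A finitely supported distribution: a list of (value , probability) atoms.
Dist : Set
Dist = List (ℚ × ℚ)

𝔼 : Dist → (ℚ → ℚ) → ℚ
𝔼 d f = sumℚ (map (λ vp → proj₂ vp * f (proj₁ vp)) d)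

record IsDist (d : Dist) : Set where
  field
    values≥0 : All (λ vp → 0ℚ ≤ proj₁ vp) d
    probs≥0  : All (λ vp → 0ℚ ≤ proj₂ vp) d
    total    : sumℚ (map proj₂ d) ≡ 1ℚ

record Instance (n : ℕ) : Set where
  field
    cost     : Fin n → ℚ
    cost≥0   : ∀ i → 0ℚ ≤ cost i
    dist     : Fin n → Dist
    distOK   : ∀ i → IsDist (dist i)
open Instance public

-- Adaptive (deterministic) policies as decision trees:
--   end      : take the highest value seen so far and end
--   take i   : action a_i^1, take box i unopened and end
--   open i k : action a_i^0, open box i, then continue with k v
--              where v is the revealed value.
data Policy (n : ℕ) : Set where
  end   : Policy n
  take  : Fin n → Policy n
  open′ : Fin n → (ℚ → Policy n) → Policy n

data Valid {n : ℕ} (used : List (Fin n)) : Policy n → Set where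
  end   : Valid used end
  take  : ∀ {i} → i ∉ used → Valid used (take i)
  open′ : ∀ {i k} → i ∉ used → (∀ v → Valid (i ∷ used) (k v)) →
          Valid used (open′ i k)

module _ {n : ℕ} (inst : Instance n) where

  -- Expected marginal payoff G of the root action of a policy in state I
  -- (conditioned on the history: boxes acted on are unopened, so by
  --  independence their conditional distribution is F_i).
  marginal : ℚ → Policy n → ℚ
  marginal I end         = 0ℚ
  marginal I (take i)    = 𝔼 (dist inst i) (λ v → v) - I
  marginal I (open′ i k) = 𝔼 (dist inst i) (λ v → (I ⊔ v) - I - cost inst i)

  payoffFrom : ℚ → Policy n → ℚ
  payoffFrom I end         = 0ℚ
  payoffFrom I (take i)    = 𝔼 (dist inst i) (λ v → v) - I
  payoffFrom I (open′ i k) =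
    𝔼 (dist inst i) (λ v → ((I ⊔ v) - I - cost inst i) + payoffFrom (I ⊔ v) (k v))

  payoff : Policy n → ℚ
  payoff = payoffFrom 0ℚ

  Optimal : Policy n → Set
  Optimal P = Valid [] P × (∀ Q → Valid [] Q → payoff Q ≤ payoff P)

  data Reach : Policy n → ℚ → Policy n → ℚ → Set where
    here  : ∀ {P I} → Reach P I P I
    there : ∀ {i k I v p Q J} → (v , p) ∈ dist inst i → 0ℚ < p →
            Reach (k v) (I ⊔ v) Q J → Reach (open′ i k) I Q J

{-# OPTIONS --safe #-}
-- If the root action of a reachable decision point Q had negative expected
-- marginal payoff, Q could be replaced by a strictly better subpolicy: `end`
-- instead of taking a box, and instead of opening box i the best of its
-- continuations k v, started from the smaller state (payoffs are antitone in
-- the state). Grafting that subpolicy into P at Q changes P only after one history,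
-- which has positive probability, so it strictly improves P, contradicting optimality.
module Submission where

open import Defs
open import Data.Nat using (ℕ)
open import Data.Rational using (ℚ; 0ℚ; 1ℚ; _+_; _*_; _-_; -_; _⊔_; _≤_; _<_; _≤?_; _≟_; nonNegative; positive)
open import Data.Rational.Properties
open import Data.Rational.Solver using (module +-*-Solver)
open import Data.Fin using (Fin)
open import Data.Product using (∃-syntax; _×_; _,_; proj₁; proj₂)
open import Data.List using (List; []; _∷_; map)
open import Data.List.Relation.Unary.All as All using (All; []; _∷_)
open import Data.List.Relation.Unary.Any using (here; there)
open import Data.List.Membership.Propositional using (_∈_)
open import Data.List.Relation.Binary.Subset.Propositional using (_⊆_)
open import Relation.Binary.Bundles using (DecTotalOrder)
open import Data.List.Extrema (DecTotalOrder.totalOrder ≤-decTotalOrder) using (argmax; f[xs]≤f[argmax])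
open import Data.Empty using (⊥-elim)
open import Function using (_∘_)
open import Relation.Nullary using (yes; no; ¬_)
open import Relation.Binary.PropositionalEquality

_≤[_]_ : (ℚ → ℚ) → Dist → (ℚ → ℚ) → Set
f ≤[ d ] g = All (λ vp → f (proj₁ vp) ≤ g (proj₁ vp)) d

Weights≥0 : Dist → Set
Weights≥0 = All (λ vp → 0ℚ ≤ proj₂ vp)

𝔼-mono : ∀ {d f g} → Weights≥0 d → f ≤[ d ] g → 𝔼 d f ≤ 𝔼 d g
𝔼-mono [] [] = ≤-refl
𝔼-mono {(_ , p) ∷ _} (p≥0 ∷ ps≥0) (fv≤gv ∷ f≤g) =
  +-mono-≤ (*-monoˡ-≤-nonNeg p {{nonNegative p≥0}} fv≤gv) (𝔼-mono ps≥0 f≤g)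

𝔼-mono-< : ∀ {d f g v p} → Weights≥0 d → f ≤[ d ] g →
           (v , p) ∈ d → 0ℚ < p → f v < g v → 𝔼 d f < 𝔼 d g
𝔼-mono-< {(_ , p) ∷ _} (_ ∷ ps≥0) (_ ∷ f≤g) (here refl) p>0 fv<gv =
  +-mono-<-≤ (*-monoʳ-<-pos p {{positive p>0}} fv<gv) (𝔼-mono ps≥0 f≤g)
𝔼-mono-< {(_ , q) ∷ _} (q≥0 ∷ ps≥0) (fw≤gw ∷ f≤g) (there v∈d) p>0 fv<gv =
  +-mono-≤-< (*-monoˡ-≤-nonNeg q {{nonNegative q≥0}} fw≤gw)
             (𝔼-mono-< ps≥0 f≤g v∈d p>0 fv<gv)

𝔼-+ : ∀ d (f g : ℚ → ℚ) → 𝔼 d (λ v → f v + g v) ≡ 𝔼 d f + 𝔼 d g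
𝔼-+ [] f g = refl
𝔼-+ ((v , p) ∷ d) f g = trans (cong (p * (f v + g v) +_) (𝔼-+ d f g))
  (solve 5 (λ p a b A B → p :* (a :+ b) :+ (A :+ B) := (p :* a :+ A) :+ (p :* b :+ B))
         refl p (f v) (g v) (𝔼 d f) (𝔼 d g))
  where open +-*-Solver

𝔼-const : ∀ d M → 𝔼 d (λ _ → M) ≡ sumℚ (map proj₂ d) * M
𝔼-const []            M = sym (*-zeroˡ M)
𝔼-const ((_ , p) ∷ d) M = trans (cong (p * M +_) (𝔼-const d M)) (sym (*-distribʳ-+ M p _))

-- Not necessarily a value in the support: the default 0ℚ wins if f 0ℚ is largest.
maximiser : Dist → (ℚ → ℚ) → ℚ
maximiser d f = proj₁ (argmax (f ∘ proj₁) (0ℚ , 0ℚ) d)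

𝔼≤f[maximiser] : ∀ {d} → IsDist d → ∀ f → 𝔼 d f ≤ f (maximiser d f)
𝔼≤f[maximiser] {d} isDist f = begin
  𝔼 d f                     ≤⟨ 𝔼-mono probs≥0 (f[xs]≤f[argmax] {f = f ∘ proj₁} _ d) ⟩
  𝔼 d (λ _ → f m)           ≡⟨ 𝔼-const d (f m) ⟩
  sumℚ (map proj₂ d) * f m  ≡⟨ cong (_* f m) total ⟩
  1ℚ * f m                  ≡⟨ *-identityˡ (f m) ⟩
  f m                       ∎
  where
  open ≤-Reasoning
  open IsDist isDist
  m = maximiser d f

⊔-excess : ∀ x v → (x ⊔ v) - x ≡ 0ℚ ⊔ (v - x)
⊔-excess x v = begin
  (x ⊔ v) - x        ≡⟨ mono-≤-distrib-⊔ (+-monoˡ-≤ (- x)) x v ⟩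
  (x - x) ⊔ (v - x)  ≡⟨ cong (_⊔ (v - x)) (+-inverseʳ x) ⟩
  0ℚ ⊔ (v - x)       ∎
  where open ≡-Reasoning

⊔-excess-antitone : ∀ v {x y} → x ≤ y → (y ⊔ v) - y ≤ (x ⊔ v) - x
⊔-excess-antitone v {x} {y} x≤y = begin
  (y ⊔ v) - y   ≡⟨ ⊔-excess y v ⟩
  0ℚ ⊔ (v - y)  ≤⟨ ⊔-monoʳ-≤ 0ℚ (+-monoʳ-≤ v (neg-antimono-≤ x≤y)) ⟩
  0ℚ ⊔ (v - x)  ≡⟨ ⊔-excess x v ⟨
  (x ⊔ v) - x   ∎
  where open ≤-Reasoning

Valid-antimono : ∀ {n} {used used′ : List (Fin n)} {P} → used ⊆ used′ → Valid used′ P → Valid used P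
Valid-antimono u⊆u′ end              = end
Valid-antimono u⊆u′ (take i∉)        = take (i∉ ∘ u⊆u′)
Valid-antimono u⊆u′ (open′ i∉ valid) =
  open′ (i∉ ∘ u⊆u′) (λ v → Valid-antimono ∷-u⊆∷-u′ (valid v))
  where
  ∷-u⊆∷-u′ : _ ⊆ _
  ∷-u⊆∷-u′ (here refl) = here refl
  ∷-u⊆∷-u′ (there x∈u) = there (u⊆u′ x∈u)

module _ {n : ℕ} where

  _[_≔_] : (ℚ → Policy n) → ℚ → Policy n → ℚ → Policy n
  (k [ v ≔ R ]) w with w ≟ v
  ... | yes _ = R
  ... | no  _ = k w

  [≔]-updated : ∀ k v (R : Policy n) → (k [ v ≔ R ]) v ≡ R
  [≔]-updated k v R with v ≟ v
  ... | yes _   = refl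
  ... | no  v≢v = ⊥-elim (v≢v refl)

  [≔]-elim : ∀ {ℓ} (C : ℚ → Policy n → Set ℓ) {k v R} →
             C v R → (∀ w → ¬ w ≡ v → C w (k w)) → ∀ w → C w ((k [ v ≔ R ]) w)
  [≔]-elim C {v = v} cR ck w with w ≟ v
  ... | yes refl = cR
  ... | no  w≢v  = ck w w≢v

module _ {n : ℕ} (inst : Instance n) where

  private
    weights≥0 : ∀ i → Weights≥0 (dist inst i)
    weights≥0 i = IsDist.probs≥0 (distOK inst i)

    gain : Fin n → ℚ → ℚ → ℚ
    gain i I v = (I ⊔ v) - I - cost inst i

  payoffFrom-antitone : ∀ P {x y} → x ≤ y → payoffFrom inst y P ≤ payoffFrom inst x P
  payoffFrom-antitone end         x≤y = ≤-refl
  payoffFrom-antitone (take i)    x≤y = +-monoʳ-≤ (𝔼 (dist inst i) (λ v → v)) (neg-antimono-≤ x≤y)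
  payoffFrom-antitone (open′ i k) {x} {y} x≤y = 𝔼-mono (weights≥0 i) (All.universal (step ∘ proj₁) _)
    where
    step : ∀ v → gain i y v + payoffFrom inst (y ⊔ v) (k v) ≤ gain i x v + payoffFrom inst (x ⊔ v) (k v)
    step v = +-mono-≤ (+-monoˡ-≤ (- cost inst i) (⊔-excess-antitone v x≤y))
                      (payoffFrom-antitone (k v) (⊔-monoˡ-≤ v x≤y))

  Improvable : List (Fin n) → ℚ → Policy n → Set
  Improvable used I P = ∃[ P′ ] Valid used P′ × payoffFrom inst I P < payoffFrom inst I P′

  marginal<0⇒improvable : ∀ {used J Q} → Valid used Q → marginal inst J Q < 0ℚ → Improvable used J Q
  marginal<0⇒improvable {Q = end}    _ 0<0 = ⊥-elim (<-irrefl refl 0<0)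
  marginal<0⇒improvable {Q = take i} _ m<0 = end , end , m<0
  marginal<0⇒improvable {J = J} {Q = open′ i k} (open′ _ valid) m<0 =
    k best , Valid-antimono there (valid best) , (begin-strict
      payoffFrom inst J (open′ i k)        ≡⟨ 𝔼-+ d A B ⟩
      𝔼 d A + 𝔼 d B                        <⟨ +-monoˡ-< (𝔼 d B) m<0 ⟩
      0ℚ + 𝔼 d B                           ≡⟨ +-identityˡ (𝔼 d B) ⟩
      𝔼 d B                                ≤⟨ 𝔼-mono (weights≥0 i) (All.universal (from-J ∘ proj₁) _) ⟩
      𝔼 d (λ v → payoffFrom inst J (k v))  ≤⟨ 𝔼≤f[maximiser] (distOK inst i) _ ⟩
      payoffFrom inst J (k best)           ∎)
    where
    open ≤-Reasoning
    d : Dist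
    d = dist inst i
    A B : ℚ → ℚ
    A = gain i J
    B v = payoffFrom inst (J ⊔ v) (k v)
    best : ℚ
    best = maximiser d (λ v → payoffFrom inst J (k v))
    from-J : ∀ v → B v ≤ payoffFrom inst J (k v)
    from-J v = payoffFrom-antitone (k v) (p≤p⊔q J v)

  opened : ∀ {P I Q J} → Reach inst P I Q J → List (Fin n) → List (Fin n)
  opened here              used = used
  opened (there {i} _ _ r) used = opened r (i ∷ used)

  Valid-reach : ∀ {P I Q J used} (r : Reach inst P I Q J) → Valid used P → Valid (opened r used) Q
  Valid-reach here                  valid           = valid
  Valid-reach (there {v = v} _ _ r) (open′ _ valid) = Valid-reach r (valid v)

  graft : ∀ {P I Q J} → Reach inst P I Q J → Policy n → Policy n
  graft here                          Q′ = Q′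
  graft (there {i} {k} {v = v} _ _ r) Q′ = open′ i (k [ v ≔ graft r Q′ ])

  graft-valid : ∀ {P I Q J used Q′} (r : Reach inst P I Q J) →
                Valid used P → Valid (opened r used) Q′ → Valid used (graft r Q′)
  graft-valid here                  _                validQ′ = validQ′
  graft-valid (there {v = v} _ _ r) (open′ i∉ valid) validQ′ =
    open′ i∉ ([≔]-elim (λ _ → Valid _) (graft-valid r (valid v) validQ′) (λ w _ → valid w))

  graft-improves : ∀ {P I Q J Q′} (r : Reach inst P I Q J) →
                   payoffFrom inst J Q < payoffFrom inst J Q′ →
                   payoffFrom inst I P < payoffFrom inst I (graft r Q′)
  graft-improves here Q<Q′ = Q<Q′
  graft-improves {I = I} {Q′ = Q′} (there {i} {k} {v = v} v∈d p>0 r) Q<Q′ =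
    𝔼-mono-< (weights≥0 i) (All.universal (λ (w , _) → +-monoʳ-≤ (gain i I w) (k≤k′ w)) _) v∈d p>0
             (+-monoʳ-< (gain i I v) k<k′-at-v)
    where
    k′ : ℚ → Policy n
    k′ = k [ v ≔ graft r Q′ ]
    k<k′-at-v : payoffFrom inst (I ⊔ v) (k v) < payoffFrom inst (I ⊔ v) (k′ v)
    k<k′-at-v rewrite [≔]-updated k v (graft r Q′) = graft-improves r Q<Q′
    k≤k′ : ∀ w → payoffFrom inst (I ⊔ w) (k w) ≤ payoffFrom inst (I ⊔ w) (k′ w)
    k≤k′ = [≔]-elim (λ w R → payoffFrom inst (I ⊔ w) (k w) ≤ payoffFrom inst (I ⊔ w) R)
                    (<⇒≤ (graft-improves r Q<Q′)) (λ _ _ → ≤-refl)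

lemma6 : ∀ {n : ℕ} (inst : Instance n) (P : Policy n) →
         Optimal inst P →
         ∀ Q J → Reach inst P 0ℚ Q J → 0ℚ ≤ marginal inst J Q
lemma6 inst P (validP , optimal) Q J r with 0ℚ ≤? marginal inst J Q
... | yes nonneg = nonneg
... | no ¬nonneg with marginal<0⇒improvable inst (Valid-reach inst r validP) (≰⇒> ¬nonneg)
... | Q′ , validQ′ , Q<Q′ =
  ⊥-elim (<-irrefl refl (<-≤-trans (graft-improves inst r Q<Q′)
                                   (optimal (graft inst r Q′) (graft-valid inst r validP validQ′))))
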